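{- Let $a,m,x,y,z$ be positive integers with $a>1$ and $m>1$ satisfying \[ (2am+1)^x+(2m)^y=(2am-1)^z . \] Then: (i) if $x$ is odd, then $y=\dfrac{v_2(a)}{v_2(m)+1}+1$; (ii) $2am \ge (2m)^y\,(x+z)^{ -y}$.
   Context: For a prime $p$ and a nonzero integer $A$, $v_p(A)$ denotes the exponent of $p$ in the prime factorization of $A$. -}

module Defs where

open import Data.Nat using (ℕ; suc; _^_)
open import Data.Nat.Divisibility using (_∣_)
open import Data.Product using (_×_)
open import Relation.Nullary using (¬_)

-- v p A ≡ k  expressed relationally: p^k divides A but p^(k+1) does not.
-- For a prime p and nonzero A this determines k uniquely as v_p(A).
IsValuation : ℕ → ℕ → ℕ → Set
IsValuation p A k = (p ^ k ∣ A) × ¬ (p ^ suc k ∣ A)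

-- Put n = 2am. To first order in n, (n + 1)^x ≡ 1 + xn and (n - 1)^(2w) ≡ 1 - 2wn modulo n².
-- Reducing the equation modulo n, an odd z would leave (2m)^y ≡ -2, forcing 2m ∣ 2; so z is even
-- and (2m)^y = n·t with t ≡ -(x + z) (mod n). When x is odd, t is odd, and comparing 2-adic
-- valuations of (2m)^y = 2am·t gives y(v₂(m) + 1) = v₂(a) + v₂(m) + 1, which is (i).
-- For (ii), since 2m ∣ n, an induction on j gives (2m)^j ∣ n(x + z)^j for all j ≤ y.
module Submission where

open import Defs
open import Data.Product using (_×_; _,_; ∃-syntax; map₂)
open import Data.Sum using (_⊎_; inj₁; inj₂; [_,_]′)
open import Data.Empty using (⊥-elim)
open import Relation.Nullary using (¬_; contradiction)
open import Relation.Binary.PropositionalEquality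
  using (_≡_; _≢_; refl; sym; trans; cong; cong₂; subst; subst₂; module ≡-Reasoning)

module ℤ-Congruences where
  open import Data.Nat.Base as ℕ using (zero; suc)
  import Data.Nat.Properties as ℕₚ
  open import Data.Integer.Base using (ℤ; +_; 0ℤ; 1ℤ; -_; _+_; _-_; _*_; _^_)
  open import Data.Integer.Properties
    using (pos-*; pos-+; *-identityʳ; ^-*-assoc; ^-distribˡ-+-*; m-n≡m⊖n; ⊖-≥)
  open import Data.Integer.Divisibility.Signed
    using (_∣_; divides; ∣-trans; ∣m⇒∣m*n; ∣n⇒∣m*n; ∣m∣n⇒∣m-n; *-monoˡ-∣; *-monoʳ-∣)
  open import Data.Integer.Tactic.RingSolver using (solve-∀)
  open ≡-Reasoning

  pos-^ : ∀ m n → + (m ℕ.^ n) ≡ (+ m) ^ n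
  pos-^ m zero = refl
  pos-^ m (suc n) = trans (pos-* m (m ℕ.^ n)) (cong (+ m *_) (pos-^ m n))

  lift-equation : ∀ {n g x z} → 1 ℕ.≤ n → (n ℕ.+ 1) ℕ.^ x ℕ.+ g ≡ (n ℕ.∸ 1) ℕ.^ z →
                  (+ n + 1ℤ) ^ x + + g ≡ (+ n - 1ℤ) ^ z
  lift-equation {n} {g} {x} {z} 1≤n eq = begin
    (+ n + 1ℤ) ^ x + + g          ≡⟨ cong (λ r → r ^ x + + g) (pos-+ n 1) ⟨
    (+ (n ℕ.+ 1)) ^ x + + g       ≡⟨ cong (_+ + g) (pos-^ (n ℕ.+ 1) x) ⟨
    + ((n ℕ.+ 1) ℕ.^ x) + + g     ≡⟨ pos-+ ((n ℕ.+ 1) ℕ.^ x) g ⟨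
    + ((n ℕ.+ 1) ℕ.^ x ℕ.+ g)     ≡⟨ cong +_ eq ⟩
    + ((n ℕ.∸ 1) ℕ.^ z)           ≡⟨ pos-^ (n ℕ.∸ 1) z ⟩
    (+ (n ℕ.∸ 1)) ^ z             ≡⟨ cong (_^ z) (trans (m-n≡m⊖n n 1) (⊖-≥ 1≤n)) ⟨
    (+ n - 1ℤ) ^ z                ∎

  ^-mod-n² : ∀ {r} b n e → r ≡ 1ℤ + b * n + n * n * e →
             ∀ k → ∃[ e′ ] r ^ k ≡ 1ℤ + + k * b * n + n * n * e′
  ^-mod-n² b n e r≡ zero = 0ℤ , k≡0 b n
    where
    k≡0 : ∀ b n → 1ℤ ≡ 1ℤ + + 0 * b * n + n * n * 0ℤ
    k≡0 = solve-∀
  ^-mod-n² b n e r≡ (suc k) with ^-mod-n² b n e r≡ k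
  ... | e′ , rᵏ≡ = _ , trans (cong₂ _*_ r≡ rᵏ≡) (expand (+ k) b n e e′)
    where
    expand : ∀ K b n e e′ → (1ℤ + b * n + n * n * e) * (1ℤ + K * b * n + n * n * e′) ≡
             1ℤ + (1ℤ + K) * b * n + n * n * (e + K * b * b + K * b * n * e + e′ + e′ * b * n + n * n * e * e′)
    expand = solve-∀

  [n+1]^k-mod-n² : ∀ n k → ∃[ e ] (n + 1ℤ) ^ k ≡ 1ℤ + + k * 1ℤ * n + n * n * e
  [n+1]^k-mod-n² n = ^-mod-n² 1ℤ n 0ℤ (n+1≡ n)
    where
    n+1≡ : ∀ n → n + 1ℤ ≡ 1ℤ + 1ℤ * n + n * n * 0ℤ
    n+1≡ = solve-∀

  [n-1]^2k-mod-n² : ∀ n k → ∃[ e ] (n - 1ℤ) ^ (2 ℕ.* k) ≡ 1ℤ + + k * - + 2 * n + n * n * e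
  [n-1]^2k-mod-n² n k =
    map₂ (trans (sym (^-*-assoc (n - 1ℤ) 2 k))) (^-mod-n² (- + 2) n 1ℤ ([n-1]²≡ n) k)
    where
    -- (n - 1ℤ) ^ 2 written out: the ring solver does not accept it as a power.
    [n-1]²≡ : ∀ n → (n - 1ℤ) * ((n - 1ℤ) * 1ℤ) ≡ 1ℤ + - + 2 * n + n * n * 1ℤ
    [n-1]²≡ = solve-∀

  i+j-i≡j : ∀ i j → i + j - i ≡ j
  i+j-i≡j = solve-∀

  even-exponent-mod-n² : ∀ n g x w → (n + 1ℤ) ^ x + g ≡ (n - 1ℤ) ^ (2 ℕ.* w) →
                         ∃[ e ] g ≡ n * (n * e - + (x ℕ.+ 2 ℕ.* w))
  even-exponent-mod-n² n g x w eq with [n+1]^k-mod-n² n x | [n-1]^2k-mod-n² n w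
  ... | A , eA | B , eB = B - A , (begin
    g
      ≡⟨ i+j-i≡j ((n + 1ℤ) ^ x) g ⟨
    (n + 1ℤ) ^ x + g - (n + 1ℤ) ^ x
      ≡⟨ cong₂ _-_ eq eA ⟩
    (n - 1ℤ) ^ (2 ℕ.* w) - (1ℤ + + x * 1ℤ * n + n * n * A)
      ≡⟨ cong (_- _) eB ⟩
    (1ℤ + + w * - + 2 * n + n * n * B) - (1ℤ + + x * 1ℤ * n + n * n * A)
      ≡⟨ collect (+ x) (+ w) n A B ⟩
    n * (n * (B - A) - (+ x + + 2 * + w))
      ≡⟨ cong (λ c → n * (n * (B - A) - c)) x+2w ⟨
    n * (n * (B - A) - + (x ℕ.+ 2 ℕ.* w)) ∎)
    where
    collect : ∀ X W n A B → (1ℤ + W * - + 2 * n + n * n * B) - (1ℤ + X * 1ℤ * n + n * n * A) ≡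
              n * (n * (B - A) - (X + + 2 * W))
    collect = solve-∀
    x+2w : + (x ℕ.+ 2 ℕ.* w) ≡ + x + + 2 * + w
    x+2w = trans (pos-+ x (2 ℕ.* w)) (cong (_+_ (+ x)) (pos-* 2 w))

  odd-exponent-mod-n : ∀ n g x w → (n + 1ℤ) ^ x + g ≡ (n - 1ℤ) ^ suc (2 ℕ.* w) →
                       ∃[ e ] g ≡ n * e - + 2
  odd-exponent-mod-n n g x w eq with [n+1]^k-mod-n² n x | [n-1]^2k-mod-n² n w
  ... | A , eA | B , eB = _ , (begin
    g
      ≡⟨ i+j-i≡j ((n + 1ℤ) ^ x) g ⟨
    (n + 1ℤ) ^ x + g - (n + 1ℤ) ^ x
      ≡⟨ cong₂ _-_ eq eA ⟩
    (n - 1ℤ) * (n - 1ℤ) ^ (2 ℕ.* w) - (1ℤ + + x * 1ℤ * n + n * n * A)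
      ≡⟨ cong (λ r → (n - 1ℤ) * r - _) eB ⟩
    (n - 1ℤ) * (1ℤ + + w * - + 2 * n + n * n * B) - (1ℤ + + x * 1ℤ * n + n * n * A)
      ≡⟨ collect (+ x) (+ w) n A B ⟩
    n * (1ℤ + + w * - + 2 * n + n * n * B + + 2 * + w - n * B - + x - n * A) - + 2 ∎)
    where
    collect : ∀ X W n A B → (n - 1ℤ) * (1ℤ + W * - + 2 * n + n * n * B) - (1ℤ + X * 1ℤ * n + n * n * A) ≡
              n * (1ℤ + W * - + 2 * n + n * n * B + + 2 * W - n * B - X - n * A) - + 2
    collect = solve-∀

  ∣n∧∣n*e-c⇒∣c : ∀ {d n e c} → d ∣ n → d ∣ n * e - c → d ∣ c
  ∣n∧∣n*e-c⇒∣c {d} {n} {e} {c} d∣n d∣ne-c =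
    subst (d ∣_) (ne-[ne-c]≡c n e c) (∣m∣n⇒∣m-n (∣m⇒∣m*n e d∣n) d∣ne-c)
    where
    ne-[ne-c]≡c : ∀ n e c → n * e - (n * e - c) ≡ c
    ne-[ne-c]≡c = solve-∀

  ^-monoʳ-∣ : ∀ d {j k} → j ℕ.≤ k → d ^ j ∣ d ^ k
  ^-monoʳ-∣ d {j} {k} j≤k = divides (d ^ (k ℕ.∸ j))
    (trans (cong (d ^_) (sym (ℕₚ.m∸n+n≡m j≤k))) (^-distribˡ-+-* d (k ℕ.∸ j) j))

  d^k∣n*c^k : ∀ {d n c e m} → d ∣ n → d ^ m ≡ n * (n * e - c) → ∀ {k} → k ℕ.≤ m → d ^ k ∣ n * c ^ k
  d^k∣n*c^k {n = n} d∣n eq {zero} _ = divides (n * 1ℤ) (sym (*-identityʳ (n * 1ℤ)))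
  d^k∣n*c^k {d} {n} {c} {e} {m} d∣n eq {suc k} k<m =
    subst (d ^ suc k ∣_) (sym split)
      (∣m∣n⇒∣m-n (∣n⇒∣m*n e dᵏ⁺¹∣n²cᵏ) (∣n⇒∣m*n (c ^ k) (^-monoʳ-∣ d k<m)))
    where
    dᵏ⁺¹∣n²cᵏ : d ^ suc k ∣ n * (n * c ^ k)
    dᵏ⁺¹∣n²cᵏ = ∣-trans (*-monoˡ-∣ (d ^ k) d∣n) (*-monoʳ-∣ n (d^k∣n*c^k d∣n eq (ℕₚ.<⇒≤ k<m)))
    identity : ∀ n c e P → n * (c * P) ≡ e * (n * (n * P)) - P * (n * (n * e - c))
    identity = solve-∀
    split : n * c ^ suc k ≡ e * (n * (n * c ^ k)) - c ^ k * d ^ m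
    split = trans (identity n c e (c ^ k)) (cong (λ t → e * (n * (n * c ^ k)) - c ^ k * t) (sym eq))

open ℤ-Congruences
  using (pos-^; lift-equation; even-exponent-mod-n²; odd-exponent-mod-n; ∣n∧∣n*e-c⇒∣c; d^k∣n*c^k)

open import Data.Nat.Base
  using (ℕ; zero; suc; _+_; _*_; _∸_; _^_; _<_; _≤_; z≤n; s≤s; NonZero; >-nonZero; nonTrivial⇒≢1)
open import Data.Nat.Properties
  using (+-comm; +-suc; *-comm; *-assoc; *-identityʳ; [m*n]*[o*p]≡[m*o]*[n*p]; ^-distribˡ-+-*;
         m^n≢0; m*n≢0; m+[n∸m]≡n; <-cmp; ≤-refl; <-≤-trans; m≤m+n; <⇒≱; *-monoʳ-<)
open import Data.Nat.Divisibility
  using (_∣_; divides; ∣-trans; 1∣_; ∣1⇒≡1; m∣m*n; ∣m+n∣m⇒∣n; *-cancelˡ-∣; ∣⇒≤)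
open import Data.Nat.Primality using (Prime; prime[2]; euclidsLemma; prime⇒nonZero; prime⇒nonTrivial)
open import Data.Nat.Tactic.RingSolver using (solve-∀)
open import Relation.Binary.Definitions using (tri<; tri≈; tri>)
open import Data.Integer.Base as ℤ using (+_; ∣_∣)
import Data.Integer.Properties as ℤₚ
import Data.Integer.Divisibility.Signed as ℤ∣
open import Data.Integer.Divisibility.Signed using (∣ᵤ⇒∣; ∣⇒∣ᵤ)
open import Data.Rational using (_/_; fromℚᵘ) renaming (_+_ to _+ℚ_)
open import Data.Rational.Properties using (toℚᵘ-injective; toℚᵘ-fromℚᵘ; toℚᵘ-homo-+; fromℚᵘ-cong)
open import Data.Rational.Unnormalised as ℚᵘ using (mkℚᵘ; *≡*)
open import Data.Rational.Unnormalised.Properties using (≃-trans; ≃-sym; +-cong)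

^-monoʳ-∣ : ∀ p {j k} → j ≤ k → p ^ j ∣ p ^ k
^-monoʳ-∣ p {j} {k} j≤k = subst (p ^ j ∣_) pʲ*pᵏ⁻ʲ≡pᵏ (m∣m*n (p ^ (k ∸ j)))
  where
  pʲ*pᵏ⁻ʲ≡pᵏ : p ^ j * p ^ (k ∸ j) ≡ p ^ k
  pʲ*pᵏ⁻ʲ≡pᵏ = trans (sym (^-distribˡ-+-* p j (k ∸ j))) (cong (p ^_) (m+[n∸m]≡n j≤k))

module _ {p : ℕ} where

  IsValuation-unique : ∀ {n j k} → IsValuation p n j → IsValuation p n k → j ≡ k
  IsValuation-unique {j = j} {k} (pʲ∣n , pʲ⁺¹∤n) (pᵏ∣n , pᵏ⁺¹∤n) with <-cmp j k
  ... | tri< j<k _ _ = contradiction (∣-trans (^-monoʳ-∣ p j<k) pᵏ∣n) pʲ⁺¹∤n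
  ... | tri≈ _ j≡k _ = j≡k
  ... | tri> _ _ k<j = contradiction (∣-trans (^-monoʳ-∣ p k<j) pʲ∣n) pᵏ⁺¹∤n

  ¬∣⇒IsValuation-0 : ∀ {n} → ¬ p ∣ n → IsValuation p n 0
  ¬∣⇒IsValuation-0 {n} p∤n = 1∣ n , λ p¹∣n → p∤n (subst (_∣ n) (*-identityʳ p) p¹∣n)

  IsValuation⇒p^k*u : ∀ {n k} → IsValuation p n k → ∃[ u ] n ≡ p ^ k * u × ¬ p ∣ u
  IsValuation⇒p^k*u {n} {k} (divides u n≡u*pᵏ , pᵏ⁺¹∤n) = u , trans n≡u*pᵏ (*-comm u (p ^ k)) , p∤u
    where
    p∤u : ¬ p ∣ u
    p∤u (divides r u≡r*p) =
      pᵏ⁺¹∤n (divides r (trans n≡u*pᵏ (trans (cong (_* p ^ k) u≡r*p) (*-assoc r p (p ^ k)))))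

  p^k*u-IsValuation : .{{NonZero p}} → ∀ k {u} → ¬ p ∣ u → IsValuation p (p ^ k * u) k
  p^k*u-IsValuation k {u} p∤u = m∣m*n u , λ pᵏ⁺¹∣pᵏu →
    p∤u (*-cancelˡ-∣ (p ^ k) {{m^n≢0 p k}} (subst (_∣ p ^ k * u) (*-comm p (p ^ k)) pᵏ⁺¹∣pᵏu))

module _ {p : ℕ} (prime-p : Prime p) where
  private instance
    p≢0 : NonZero p
    p≢0 = prime⇒nonZero prime-p

  p∤1 : ¬ p ∣ 1
  p∤1 p∣1 = nonTrivial⇒≢1 {{prime⇒nonTrivial prime-p}} (∣1⇒≡1 p∣1)

  IsValuation-self : IsValuation p p 1
  IsValuation-self = subst (λ n → IsValuation p n 1) p¹*1≡p (p^k*u-IsValuation {p} 1 p∤1)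
    where
    p¹*1≡p : p ^ 1 * 1 ≡ p
    p¹*1≡p = trans (*-identityʳ (p ^ 1)) (*-identityʳ p)

  IsValuation-* : ∀ {m n j k} → IsValuation p m j → IsValuation p n k → IsValuation p (m * n) (j + k)
  IsValuation-* {m} {n} {j} {k} vm vn
    with IsValuation⇒p^k*u {p} {m} {j} vm | IsValuation⇒p^k*u {p} {n} {k} vn
  ... | u , refl , p∤u | v , refl , p∤v =
    subst (λ n → IsValuation p n (j + k)) regroup (p^k*u-IsValuation {p} (j + k) p∤uv)
    where
    p∤uv : ¬ p ∣ u * v
    p∤uv p∣uv = [ p∤u , p∤v ]′ (euclidsLemma u v prime-p p∣uv)
    regroup : p ^ (j + k) * (u * v) ≡ p ^ j * u * (p ^ k * v)
    regroup = trans (cong (_* (u * v)) (^-distribˡ-+-* p j k)) ([m*n]*[o*p]≡[m*o]*[n*p] (p ^ j) (p ^ k) u v)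

  IsValuation-^ : ∀ {n k} → IsValuation p n k → ∀ y → IsValuation p (n ^ y) (y * k)
  IsValuation-^ vn zero = ¬∣⇒IsValuation-0 {p} p∤1
  IsValuation-^ {k = k} vn (suc y) = IsValuation-* {j = k} {y * k} vn (IsValuation-^ vn y)

  [pm]^y≡pamt⇒y*[1+μ]≡α+[1+μ] : ∀ {a m t α μ} y → IsValuation p a α → IsValuation p m μ → ¬ p ∣ t →
                                (p * m) ^ y ≡ p * a * m * t → y * suc μ ≡ α + suc μ
  [pm]^y≡pamt⇒y*[1+μ]≡α+[1+μ] {a} {m} {t} {α} {μ} y va vm p∤t eq =
    trans (IsValuation-unique {p} (subst (λ n → IsValuation p n (y * suc μ)) eq v-lhs) v-rhs) (arith α μ)
    where
    v-lhs : IsValuation p ((p * m) ^ y) (y * suc μ)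
    v-lhs = IsValuation-^ {k = suc μ} (IsValuation-* {j = 1} {μ} IsValuation-self vm) y
    v-rhs : IsValuation p (p * a * m * t) (1 + α + μ + 0)
    v-rhs = IsValuation-* {j = 1 + α + μ} {0}
              (IsValuation-* {j = 1 + α} {μ} (IsValuation-* {j = 1} {α} IsValuation-self va) vm)
              (¬∣⇒IsValuation-0 {p} p∤t)
    arith : ∀ α μ → 1 + α + μ + 0 ≡ α + suc μ
    arith = solve-∀

fromℚᵘ-homo-+ : ∀ p q → fromℚᵘ (p ℚᵘ.+ q) ≡ fromℚᵘ p +ℚ fromℚᵘ q
fromℚᵘ-homo-+ p q = toℚᵘ-injective (≃-trans (toℚᵘ-fromℚᵘ (p ℚᵘ.+ q))
  (≃-sym (≃-trans (toℚᵘ-homo-+ (fromℚᵘ p) (fromℚᵘ q)) (+-cong (toℚᵘ-fromℚᵘ p) (toℚᵘ-fromℚᵘ q)))))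

y*[1+d]≡α+[1+d]⇒y≡α/[1+d]+1 : ∀ {y α d} → y * suc d ≡ α + suc d → + y / 1 ≡ + α / suc d +ℚ + 1 / 1
y*[1+d]≡α+[1+d]⇒y≡α/[1+d]+1 {y} {α} {d} eq =
  trans (fromℚᵘ-cong {mkℚᵘ (+ y) 0} {mkℚᵘ (+ α) d ℚᵘ.+ mkℚᵘ (+ 1) 0} (*≡* cross-multiplied))
        (fromℚᵘ-homo-+ (mkℚᵘ (+ α) d) (mkℚᵘ (+ 1) 0))
  where
  open ≡-Reasoning
  cross-multiplied : + y ℤ.* + suc (d * 1) ≡ (+ α ℤ.* + 1 ℤ.+ + 1 ℤ.* + suc d) ℤ.* + 1
  cross-multiplied = begin
    + y ℤ.* + suc (d * 1)                          ≡⟨ cong (λ k → + y ℤ.* + k) (*-identityʳ (suc d)) ⟩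
    + y ℤ.* + suc d                                ≡⟨ ℤₚ.pos-* y (suc d) ⟨
    + (y * suc d)                                  ≡⟨ cong +_ eq ⟩
    + (α + suc d)                                  ≡⟨ ℤₚ.pos-+ α (suc d) ⟩
    + α ℤ.+ + suc d                                ≡⟨ cong₂ ℤ._+_ (ℤₚ.*-identityʳ (+ α)) (ℤₚ.*-identityˡ (+ suc d)) ⟨
    + α ℤ.* + 1 ℤ.+ + 1 ℤ.* + suc d                ≡⟨ ℤₚ.*-identityʳ _ ⟨
    (+ α ℤ.* + 1 ℤ.+ + 1 ℤ.* + suc d) ℤ.* + 1      ∎

even⊎odd : ∀ n → (∃[ w ] n ≡ 2 * w) ⊎ (∃[ w ] n ≡ suc (2 * w))
even⊎odd zero = inj₁ (0 , refl)
even⊎odd (suc n) with even⊎odd n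
... | inj₁ (w , refl) = inj₂ (w , refl)
... | inj₂ (w , refl) = inj₁ (suc w , cong suc (sym (+-suc w (w + 0))))

2m∣2am : ∀ a m → 2 * m ∣ 2 * a * m
2m∣2am a m = divides a (2am≡a*2m a m)
  where
  2am≡a*2m : ∀ a m → 2 * a * m ≡ a * (2 * m)
  2am≡a*2m = solve-∀

[2m]^y≢2am*e-2 : ∀ {a m y} e → 1 < m → 0 < y → + ((2 * m) ^ y) ≢ + (2 * a * m) ℤ.* e ℤ.- + 2
[2m]^y≢2am*e-2 {a} {m} {suc y} e 1<m _ g≡2am*e-2 = <⇒≱ (*-monoʳ-< 2 1<m) (∣⇒≤ (∣⇒∣ᵤ 2m∣2))
  where
  2m∣g : + (2 * m) ℤ∣.∣ + ((2 * m) ^ suc y)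
  2m∣g = ∣ᵤ⇒∣ (m∣m*n ((2 * m) ^ y))
  2m∣2 : + (2 * m) ℤ∣.∣ + 2
  2m∣2 = ∣n∧∣n*e-c⇒∣c {n = + (2 * a * m)} {e} {+ 2}
           (∣ᵤ⇒∣ (2m∣2am a m)) (subst (+ (2 * m) ℤ∣.∣_) g≡2am*e-2 2m∣g)

d^y≤n*c^y : ∀ {d n c y} e → d ∣ n → 0 < n → 0 < c →
            + (d ^ y) ≡ + n ℤ.* (+ n ℤ.* e ℤ.- + c) → d ^ y ≤ n * c ^ y
d^y≤n*c^y {d} {n} {c} {y} e d∣n 0<n 0<c eq =
  ∣⇒≤ {{n*cʸ≢0}} (∣⇒∣ᵤ (subst₂ ℤ∣._∣_ (sym (pos-^ d y)) n*c^y≡ dʸ∣n*cʸ))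
  where
  dʸ∣n*cʸ : (+ d) ℤ.^ y ℤ∣.∣ + n ℤ.* (+ c) ℤ.^ y
  dʸ∣n*cʸ = d^k∣n*c^k {+ d} {+ n} {+ c} {e} {y} (∣ᵤ⇒∣ d∣n) (trans (sym (pos-^ d y)) eq) ≤-refl
  n*c^y≡ : + n ℤ.* (+ c) ℤ.^ y ≡ + (n * c ^ y)
  n*c^y≡ = trans (cong (+ n ℤ.*_) (sym (pos-^ c y))) (sym (ℤₚ.pos-* n (c ^ y)))
  n*cʸ≢0 : NonZero (n * c ^ y)
  n*cʸ≢0 = m*n≢0 n (c ^ y) {{>-nonZero 0<n}} {{m^n≢0 c y {{>-nonZero 0<c}}}}

0<2am : ∀ {a m} → 1 < a → 1 < m → 0 < 2 * a * m
0<2am {suc a} {suc m} (s≤s _) (s≤s _) = s≤s z≤n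

y≡v₂a/[v₂m+1]+1 : ∀ {a m x y w e α μ} → ¬ 2 ∣ x → IsValuation 2 a α → IsValuation 2 m μ →
                  + ((2 * m) ^ y) ≡ + (2 * a * m) ℤ.* (+ (2 * a * m) ℤ.* e ℤ.- + (x + 2 * w)) →
                  + y / 1 ≡ + α / suc μ +ℚ + 1 / 1
y≡v₂a/[v₂m+1]+1 {a} {m} {x} {y} {w} {e} {α} {μ} 2∤x vα vμ eq =
  y*[1+d]≡α+[1+d]⇒y≡α/[1+d]+1 {y}
    ([pm]^y≡pamt⇒y*[1+μ]≡α+[1+μ] prime[2] {a} {m} {∣ t ∣} {α} {μ} y vα vμ 2∤t eqℕ)
  where
  t : ℤ.ℤ
  t = + (2 * a * m) ℤ.* e ℤ.- + (x + 2 * w)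
  eqℕ : (2 * m) ^ y ≡ 2 * a * m * ∣ t ∣
  eqℕ = trans (cong ∣_∣ eq) (ℤₚ.abs-* (+ (2 * a * m)) t)
  2∣2am : 2 ∣ 2 * a * m
  2∣2am = ∣-trans (m∣m*n a) (m∣m*n m)
  2∤t : ¬ 2 ∣ ∣ t ∣
  2∤t 2∣t = 2∤x (∣m+n∣m⇒∣n (subst (2 ∣_) (+-comm x (2 * w)) 2∣x+2w) (m∣m*n w))
    where
    2∣x+2w : 2 ∣ x + 2 * w
    2∣x+2w = ∣⇒∣ᵤ (∣n∧∣n*e-c⇒∣c {+ 2} {+ (2 * a * m)} {e} {+ (x + 2 * w)}
                                 (∣ᵤ⇒∣ 2∣2am) (∣ᵤ⇒∣ {+ 2} {t} 2∣t))

lemma2p1 : (a m x y z : ℕ) → 1 < a → 1 < m → 0 < x → 0 < y → 0 < z →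
    (2 * a * m + 1) ^ x + (2 * m) ^ y ≡ (2 * a * m ∸ 1) ^ z →
    ((¬ (2 ∣ x) → (α μ : ℕ) → IsValuation 2 a α → IsValuation 2 m μ →
        (+ y / 1) ≡ (+ α / suc μ) +ℚ (+ 1 / 1))
    × ((2 * m) ^ y ≤ 2 * a * m * (x + z) ^ y))
lemma2p1 a m x y z 1<a 1<m 0<x 0<y _ eq with even⊎odd z | lift-equation {x = x} {z} (0<2am 1<a 1<m) eq
... | inj₂ (w , refl) | eqℤ =
  let e , eq-mod-n = odd-exponent-mod-n (+ (2 * a * m)) (+ ((2 * m) ^ y)) x w eqℤ
  in ⊥-elim ([2m]^y≢2am*e-2 {a} e 1<m 0<y eq-mod-n)
... | inj₁ (w , refl) | eqℤ =
  let e , eq-mod-n² = even-exponent-mod-n² (+ (2 * a * m)) (+ ((2 * m) ^ y)) x w eqℤ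
  in (λ 2∤x α μ vα vμ → y≡v₂a/[v₂m+1]+1 {y = y} {w} {e} {α} {μ} 2∤x vα vμ eq-mod-n²) ,
     d^y≤n*c^y {y = y} e (2m∣2am a m) (0<2am 1<a 1<m) (<-≤-trans 0<x (m≤m+n x z)) eq-mod-n²
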